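{- Let $\mathcal{P}=(p_{ij})_{i,j\ge 0}$ be the infinite matrix with $p_{ij}=\binom{i+j}{i}\bmod 2$. Fix $k\ge 1$ and let $\mathcal{P}_k$ be its upper-left $2^{k}\times 2^{k}$ submatrix (indices $0\le i,j\le 2^k-1$). Then the sum modulo $2$ of row $i$ of $\mathcal{P}_k$ is $0$ for $0\le i<2^{k}-1$ and is $1$ for $i=2^{k}-1$. -}

module Defs where

open import Data.Nat using (ℕ; _+_; _%_)
open import Data.Nat.Combinatorics using (_C_)
open import Data.List using (map; upTo)
open import Data.Nat.ListAction using (sum)

p : ℕ → ℕ → ℕ
p i j = ((i + j) C i) % 2

rowSum : ℕ → ℕ → ℕ
rowSum N i = sum (map (p i) (upTo N))

-- Hockey stick: the i-th row sum of the N × N corner is C(i + N, i + 1). Over 𝔽₂ the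
-- Frobenius identity (1 + X)^(2^k) = 1 + X^(2^k) gives
-- (1 + X)^(2^k + i) = (1 + X)^i + X^(2^k) (1 + X)^i, and the coefficient of X^(i+1)
-- on the right is C(i, i + 1) + C(i, i + 1 − 2^k), which vanishes for i + 1 < 2^k and
-- is C(i, 0) = 1 for i + 1 = 2^k.
module Submission where

open import Defs
open import Data.Nat using (ℕ; _≤_; _<_; _^_; _∸_; _%_; zero; suc; _+_; s≤s; parity)
open import Data.Nat.Combinatorics using (_C_; nCk+nC[k+1]≡[n+1]C[k+1]; k>n⇒nCk≡0)
open import Data.Nat.Properties using (+-suc; +-comm; +-identityʳ; n<1+n; m^n>0; m+[n∸m]≡n; <-≤-trans; ≤-reflexive)
open import Data.Nat.DivMod using ([m+n]%n≡m%n)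
open import Data.Nat.ListAction using (sum)
open import Data.Nat.ListAction.Properties using (sum-++)
open import Data.List using (map; upTo; [_]; _++_)
open import Data.List.Properties using (upTo-∷ʳ; map-++)
open import Data.Parity.Base as ℙ using (Parity; 0ℙ; 1ℙ)
import Data.Parity.Properties as ℙ
open import Algebra.Properties.CommutativeSemigroup ℙ.+-commutativeSemigroup using (interchange)
open import Data.Product using (_×_; _,_)
open import Function using (_∘_)
open import Relation.Binary.PropositionalEquality
  using (_≡_; _≗_; refl; sym; trans; cong; cong₂; _→-setoid_; module ≡-Reasoning)
import Relation.Binary.Reasoning.Setoid as SetoidReasoning

toℕ : Parity → ℕ
toℕ 0ℙ = 0
toℕ 1ℙ = 1

toℕ-parity : ∀ n → toℕ (parity n) ≡ n % 2
toℕ-parity zero = refl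
toℕ-parity (suc zero) = refl
toℕ-parity (suc (suc n)) = begin
  toℕ (parity n)  ≡⟨ toℕ-parity n ⟩
  n % 2           ≡⟨ sym ([m+n]%n≡m%n n 2) ⟩
  (n + 2) % 2     ≡⟨ cong (_% 2) (+-comm n 2) ⟩
  (2 + n) % 2     ∎
  where open ≡-Reasoning

parity-toℕ : ∀ p → parity (toℕ p) ≡ p
parity-toℕ 0ℙ = refl
parity-toℕ 1ℙ = refl

parity-%2 : ∀ n → parity (n % 2) ≡ parity n
parity-%2 n = trans (cong parity (sym (toℕ-parity n))) (parity-toℕ (parity n))

Series : Set
Series = ℕ → Parity

infixl 6 _⊕_
infixr 8 X^_·_ [1+X]^_·_

_⊕_ : Series → Series → Series
(f ⊕ g) r = f r ℙ.+ g r

one : Series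
one zero = 1ℙ
one (suc r) = 0ℙ

X^_·_ : ℕ → Series → Series
(X^ zero · f) r = f r
(X^ suc d · f) zero = 0ℙ
(X^ suc d · f) (suc r) = (X^ d · f) r

[1+X]·_ : Series → Series
[1+X]· f = f ⊕ X^ 1 · f

[1+X]^_·_ : ℕ → Series → Series
[1+X]^ zero · f = f
[1+X]^ suc n · f = [1+X]· ([1+X]^ n · f)

⊕-cong : ∀ {f f′ g g′} → f ≗ f′ → g ≗ g′ → f ⊕ g ≗ f′ ⊕ g′
⊕-cong f≗f′ g≗g′ r = cong₂ ℙ._+_ (f≗f′ r) (g≗g′ r)

⊕-congˡ : ∀ f {g g′} → g ≗ g′ → f ⊕ g ≗ f ⊕ g′
⊕-congˡ f g≗g′ r = cong (f r ℙ.+_) (g≗g′ r)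

⊕-interchange : ∀ f g h e → (f ⊕ g) ⊕ (h ⊕ e) ≗ (f ⊕ h) ⊕ (g ⊕ e)
⊕-interchange f g h e r = interchange (f r) (g r) (h r) (e r)

⊕-cancel-middle : ∀ f g h → (f ⊕ g) ⊕ (g ⊕ h) ≗ f ⊕ h
⊕-cancel-middle f g h r = begin
  (f r ℙ.+ g r) ℙ.+ (g r ℙ.+ h r)  ≡⟨ ℙ.+-assoc (f r) (g r) _ ⟩
  f r ℙ.+ (g r ℙ.+ (g r ℙ.+ h r))  ≡⟨ cong (f r ℙ.+_) (sym (ℙ.+-assoc (g r) (g r) (h r))) ⟩
  f r ℙ.+ ((g r ℙ.+ g r) ℙ.+ h r)  ≡⟨ cong (λ x → f r ℙ.+ (x ℙ.+ h r)) (ℙ.p+p≡0ℙ (g r)) ⟩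
  f r ℙ.+ h r                      ∎
  where open ≡-Reasoning

X^-cong : ∀ d {f g} → f ≗ g → X^ d · f ≗ X^ d · g
X^-cong zero f≗g r = f≗g r
X^-cong (suc d) f≗g zero = refl
X^-cong (suc d) f≗g (suc r) = X^-cong d f≗g r

X^-⊕ : ∀ d f g → X^ d · (f ⊕ g) ≗ X^ d · f ⊕ X^ d · g
X^-⊕ zero f g r = refl
X^-⊕ (suc d) f g zero = refl
X^-⊕ (suc d) f g (suc r) = X^-⊕ d f g r

X^-+ : ∀ m n f → X^ m · X^ n · f ≗ X^ (m + n) · f
X^-+ zero n f r = refl
X^-+ (suc m) n f zero = refl
X^-+ (suc m) n f (suc r) = X^-+ m n f r

X^-below : ∀ {d r} f → r < d → (X^ d · f) r ≡ 0ℙ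
X^-below {suc d} {zero} f _ = refl
X^-below {suc d} {suc r} f (s≤s r<d) = X^-below f r<d

X^-shift : ∀ d r f → (X^ d · f) (d + r) ≡ f r
X^-shift zero r f = refl
X^-shift (suc d) r f = X^-shift d r f

X^-comm : ∀ m n f → X^ m · X^ n · f ≗ X^ n · X^ m · f
X^-comm m n f r = begin
  (X^ m · X^ n · f) r  ≡⟨ X^-+ m n f r ⟩
  (X^ (m + n) · f) r   ≡⟨ cong (λ d → (X^ d · f) r) (+-comm m n) ⟩
  (X^ (n + m) · f) r   ≡⟨ X^-+ n m f r ⟨
  (X^ n · X^ m · f) r  ∎
  where open ≡-Reasoning

module ≗-Reasoning = SetoidReasoning (ℕ →-setoid Parity)

[1+X]^-cong : ∀ n {f g} → f ≗ g → [1+X]^ n · f ≗ [1+X]^ n · g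
[1+X]^-cong zero f≗g = f≗g
[1+X]^-cong (suc n) f≗g = ⊕-cong h≗h′ (X^-cong 1 h≗h′)
  where h≗h′ = [1+X]^-cong n f≗g

[1+X]^-+ : ∀ m n f → [1+X]^ (m + n) · f ≡ [1+X]^ m · [1+X]^ n · f
[1+X]^-+ zero n f = refl
[1+X]^-+ (suc m) n f = cong [1+X]·_ ([1+X]^-+ m n f)

[1+X]^-⊕ : ∀ n f g → [1+X]^ n · (f ⊕ g) ≗ [1+X]^ n · f ⊕ [1+X]^ n · g
[1+X]^-⊕ zero f g = λ _ → refl
[1+X]^-⊕ (suc n) f g = begin
  [1+X]· ([1+X]^ n · (f ⊕ g))            ≈⟨ ⊕-cong IH (X^-cong 1 IH) ⟩
  (F ⊕ G) ⊕ X^ 1 · (F ⊕ G)               ≈⟨ ⊕-congˡ (F ⊕ G) (X^-⊕ 1 F G) ⟩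
  (F ⊕ G) ⊕ (X^ 1 · F ⊕ X^ 1 · G)        ≈⟨ ⊕-interchange F G (X^ 1 · F) (X^ 1 · G) ⟩
  [1+X]· F ⊕ [1+X]· G                    ∎
  where
  open ≗-Reasoning
  F = [1+X]^ n · f
  G = [1+X]^ n · g
  IH = [1+X]^-⊕ n f g

[1+X]^-X^ : ∀ n d f → [1+X]^ n · X^ d · f ≗ X^ d · [1+X]^ n · f
[1+X]^-X^ zero d f = λ _ → refl
[1+X]^-X^ (suc n) d f = begin
  [1+X]· ([1+X]^ n · X^ d · f)           ≈⟨ ⊕-cong IH (X^-cong 1 IH) ⟩
  X^ d · F ⊕ X^ 1 · X^ d · F             ≈⟨ ⊕-congˡ (X^ d · F) (X^-comm 1 d F) ⟩
  X^ d · F ⊕ X^ d · X^ 1 · F             ≈⟨ X^-⊕ d F (X^ 1 · F) ⟨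
  X^ d · [1+X]· F                        ∎
  where
  open ≗-Reasoning
  F = [1+X]^ n · f
  IH = [1+X]^-X^ n d f

[1+X]^2^k : ∀ k f → [1+X]^ (2 ^ k) · f ≗ f ⊕ X^ (2 ^ k) · f
[1+X]^2^k zero f = λ _ → refl
[1+X]^2^k (suc k) f = begin
  [1+X]^ (d + (d + 0)) · f               ≡⟨ cong (λ n → [1+X]^ (d + n) · f) (+-identityʳ d) ⟩
  [1+X]^ (d + d) · f                     ≡⟨ [1+X]^-+ d d f ⟩
  [1+X]^ d · [1+X]^ d · f                ≈⟨ [1+X]^-cong d (IH f) ⟩
  [1+X]^ d · (f ⊕ X^ d · f)              ≈⟨ [1+X]^-⊕ d f (X^ d · f) ⟩
  [1+X]^ d · f ⊕ [1+X]^ d · X^ d · f     ≈⟨ ⊕-cong (IH f) ([1+X]^-X^ d d f) ⟩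
  (f ⊕ X^ d · f) ⊕ X^ d · [1+X]^ d · f   ≈⟨ ⊕-congˡ (f ⊕ X^ d · f) (X^-cong d (IH f)) ⟩
  (f ⊕ X^ d · f) ⊕ X^ d · (f ⊕ X^ d · f) ≈⟨ ⊕-congˡ (f ⊕ X^ d · f) (X^-⊕ d f (X^ d · f)) ⟩
  (f ⊕ X^ d · f) ⊕ (X^ d · f ⊕ X^ d · X^ d · f)
                                         ≈⟨ ⊕-cancel-middle f (X^ d · f) _ ⟩
  f ⊕ X^ d · X^ d · f                    ≈⟨ ⊕-congˡ f (X^-+ d d f) ⟩
  f ⊕ X^ (d + d) · f                     ≡⟨ cong (λ n → f ⊕ X^ (d + n) · f) (+-identityʳ d) ⟨
  f ⊕ X^ (d + (d + 0)) · f               ∎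
  where
  open ≗-Reasoning
  d = 2 ^ k
  IH = [1+X]^2^k k

parity-C : ∀ n r → parity (n C r) ≡ ([1+X]^ n · one) r
parity-C zero zero = refl
parity-C zero (suc r) = refl
parity-C (suc n) zero = trans (parity-C n zero) (sym (ℙ.+-identityʳ _))
parity-C (suc n) (suc r) = begin
  parity (suc n C suc r)                  ≡⟨ cong parity (nCk+nC[k+1]≡[n+1]C[k+1] n r) ⟨
  parity (n C r + n C suc r)              ≡⟨ ℙ.+-homo-+ (n C r) (n C suc r) ⟩
  parity (n C r) ℙ.+ parity (n C suc r)   ≡⟨ cong₂ ℙ._+_ (parity-C n r) (parity-C n (suc r)) ⟩
  b r ℙ.+ b (suc r)                       ≡⟨ ℙ.+-comm (b r) (b (suc r)) ⟩
  b (suc r) ℙ.+ b r                       ∎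
  where
  open ≡-Reasoning
  b = [1+X]^ n · one

rowSum-suc : ∀ N i → rowSum (suc N) i ≡ rowSum N i + p i N
rowSum-suc N i = begin
  sum (map (p i) (upTo (suc N)))          ≡⟨ cong (sum ∘ map (p i)) (upTo-∷ʳ N) ⟨
  sum (map (p i) (upTo N ++ [ N ]))       ≡⟨ cong sum (map-++ (p i) (upTo N) [ N ]) ⟩
  sum (map (p i) (upTo N) ++ [ p i N ])   ≡⟨ sum-++ (map (p i) (upTo N)) [ p i N ] ⟩
  rowSum N i + (p i N + 0)                ≡⟨ cong (rowSum N i +_) (+-identityʳ (p i N)) ⟩
  rowSum N i + p i N                      ∎
  where open ≡-Reasoning

parity-rowSum : ∀ N i → parity (rowSum N i) ≡ parity ((i + N) C suc i)
parity-rowSum zero i rewrite +-identityʳ i = cong parity (sym (k>n⇒nCk≡0 (n<1+n i)))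
parity-rowSum (suc N) i = begin
  parity (rowSum (suc N) i)                    ≡⟨ cong parity (rowSum-suc N i) ⟩
  parity (rowSum N i + p i N)                  ≡⟨ ℙ.+-homo-+ (rowSum N i) (p i N) ⟩
  parity (rowSum N i) ℙ.+ parity (p i N)       ≡⟨ cong₂ ℙ._+_ (parity-rowSum N i) (parity-%2 (n C i)) ⟩
  parity (n C suc i) ℙ.+ parity (n C i)        ≡⟨ ℙ.+-comm (parity (n C suc i)) _ ⟩
  parity (n C i) ℙ.+ parity (n C suc i)        ≡⟨ ℙ.+-homo-+ (n C i) (n C suc i) ⟨
  parity (n C i + n C suc i)                   ≡⟨ cong parity (nCk+nC[k+1]≡[n+1]C[k+1] n i) ⟩
  parity (suc n C suc i)                       ≡⟨ cong (λ m → parity (m C suc i)) (+-suc i N) ⟨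
  parity ((i + suc N) C suc i)                 ∎
  where
  open ≡-Reasoning
  n = i + N

parity-rowSum-2^k : ∀ k i → parity (rowSum (2 ^ k) i) ≡ (X^ (2 ^ k) · [1+X]^ i · one) (suc i)
parity-rowSum-2^k k i = begin
  parity (rowSum N i)                  ≡⟨ parity-rowSum N i ⟩
  parity ((i + N) C suc i)             ≡⟨ cong (λ n → parity (n C suc i)) (+-comm i N) ⟩
  parity ((N + i) C suc i)             ≡⟨ parity-C (N + i) (suc i) ⟩
  ([1+X]^ (N + i) · one) (suc i)       ≡⟨ cong (λ f → f (suc i)) ([1+X]^-+ N i one) ⟩
  ([1+X]^ N · b) (suc i)               ≡⟨ [1+X]^2^k k b (suc i) ⟩
  b (suc i) ℙ.+ (X^ N · b) (suc i)     ≡⟨ cong (ℙ._+ (X^ N · b) (suc i)) b[1+i]≡0 ⟩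
  (X^ N · b) (suc i)                   ∎
  where
  open ≡-Reasoning
  N = 2 ^ k
  b = [1+X]^ i · one
  b[1+i]≡0 : b (suc i) ≡ 0ℙ
  b[1+i]≡0 = trans (sym (parity-C i (suc i))) (cong parity (k>n⇒nCk≡0 (n<1+n i)))

lemma4 : (k : ℕ) → 1 ≤ k →
           ((i : ℕ) → i < 2 ^ k ∸ 1 → rowSum (2 ^ k) i % 2 ≡ 0)
           × (rowSum (2 ^ k) (2 ^ k ∸ 1) % 2 ≡ 1)
lemma4 k _ = inner , last
  where
  N = 2 ^ k
  1+[N∸1]≡N : suc (N ∸ 1) ≡ N
  1+[N∸1]≡N = m+[n∸m]≡n (m^n>0 2 k)
  rowSum%2 : ∀ i → rowSum N i % 2 ≡ toℕ ((X^ N · [1+X]^ i · one) (suc i))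
  rowSum%2 i = trans (sym (toℕ-parity (rowSum N i))) (cong toℕ (parity-rowSum-2^k k i))
  inner : (i : ℕ) → i < N ∸ 1 → rowSum N i % 2 ≡ 0
  inner i i<N∸1 = trans (rowSum%2 i) (cong toℕ (X^-below _ 1+i<N))
    where
    1+i<N : suc i < N
    1+i<N = <-≤-trans (s≤s i<N∸1) (≤-reflexive 1+[N∸1]≡N)
  last : rowSum N (N ∸ 1) % 2 ≡ 1
  last = begin
    rowSum N (N ∸ 1) % 2              ≡⟨ rowSum%2 (N ∸ 1) ⟩
    toℕ ((X^ N · b) (suc (N ∸ 1)))    ≡⟨ cong (toℕ ∘ (X^ N · b)) 1+[N∸1]≡N ⟩
    toℕ ((X^ N · b) N)                ≡⟨ cong (toℕ ∘ (X^ N · b)) (+-identityʳ N) ⟨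
    toℕ ((X^ N · b) (N + 0))          ≡⟨ cong toℕ (X^-shift N 0 b) ⟩
    toℕ (b 0)                         ≡⟨ cong toℕ (parity-C (N ∸ 1) 0) ⟨
    1                                 ∎
    where
    open ≡-Reasoning
    b = [1+X]^ (N ∸ 1) · one
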